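{- Let $H$ be a $2$-connected maximal outerplanar graph with diameter $3$ and maximum degree $\Delta$, and suppose $H$ contains six vertices $v_0,\dots,v_5$ inducing the graph with edges $v_0v_2,v_0v_3,v_2v_3,v_0v_1,v_1v_2,v_0v_4,v_4v_3,v_2v_5,v_5v_3$ (a triangle $v_0v_2v_3$ with one further vertex adjacent to both ends of each of its edges), such that $d(v_0)=d(v_2)=d(v_3)=\Delta$. Then $\chi'_{st}(H)\ge \Delta+2$.
   Context: All graphs are finite, simple and undirected; $d(v)$ is the degree of $v$. An outerplanar graph is a graph that can be drawn in the plane without edge crossings with all vertices on the outer face; it is maximal outerplanar if adding any edge between nonadjacent vertices destroys outerplanarity. The diameter is the maximum distance between two vertices. A star edge coloring is a proper edge coloring with no path or cycle of length four (four edges) colored with only two colors; $\chi'_{st}(H)$ is the minimum number of colors in a star edge coloring of $H$. (In the paper this graph is denoted $H_{n_\Delta}$.) -}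

module Defs where

open import Data.Nat using (ℕ; zero; suc; _≤_; _<_; _+_)
open import Data.Fin using (Fin; toℕ)
open import Data.Fin.Properties using (_≟_)
open import Data.Bool using (Bool; true; false; _∨_; _∧_)
open import Data.Product using (Σ; ∃; ∃-syntax; _×_; _,_)
open import Data.Sum using (_⊎_)
open import Data.Unit using (⊤)
open import Data.Empty using (⊥)
open import Data.List using (List; filter; length)
open import Data.List using () renaming (allFin to allFinL)
open import Relation.Nullary using (¬_; ⌊_⌋)
open import Relation.Binary.PropositionalEquality using (_≡_; _≢_)
open import Function.Definitions using (Injective)
open import Data.Bool.Properties using () renaming (_≟_ to _≟B_)

record Graph : Set where
  field
    n     : ℕ
    adj   : Fin n → Fin n → Bool
    sym   : ∀ u v → adj u v ≡ adj v u
    irref : ∀ u → adj u u ≡ false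

open Graph public

Edge : (G : Graph) → Fin (n G) → Fin (n G) → Set
Edge G u v = adj G u v ≡ true

degree : (G : Graph) → Fin (n G) → ℕ
degree G v = length (filter (λ w → adj G v w ≟B true) (allFinL (n G)))

IsMaxDegree : (G : Graph) → ℕ → Set
IsMaxDegree G Δ = (∀ v → degree G v ≤ Δ) × (∃[ v ] degree G v ≡ Δ)

-- Walks. 'Walk G ok k u v': a walk from u to v with at most k edges,
-- all of whose vertices satisfy 'ok'.

data Walk (G : Graph) (ok : Fin (n G) → Set) : ℕ → Fin (n G) → Fin (n G) → Set where
  here : ∀ {k u} → ok u → Walk G ok k u u
  step : ∀ {k u w v} → ok u → Edge G u w → Walk G ok k w v → Walk G ok (suc k) u v

Everywhere : (G : Graph) → Fin (n G) → Set
Everywhere G _ = ⊤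

DistLe : (G : Graph) → ℕ → Fin (n G) → Fin (n G) → Set
DistLe G k u v = Walk G (Everywhere G) k u v

Connected : (G : Graph) → Set
Connected G = ∀ u v → ∃[ k ] DistLe G k u v

TwoConnected : (G : Graph) → Set
TwoConnected G =
  (3 ≤ n G) × Connected G ×
  (∀ x u v → u ≢ x → v ≢ x → ∃[ k ] Walk G (λ y → y ≢ x) k u v)

HasDiameter : (G : Graph) → ℕ → Set
HasDiameter G d =
  Connected G × (∀ u v → DistLe G d u v) ×
  (∃[ u ] ∃[ v ] ∀ e → e < d → ¬ DistLe G e u v)

-- Outerplanarity (combinatorial rendering): the vertices can be placed on
-- a circle, in the cyclic order given by a bijective position map σ,
-- such that no two edges (drawn as chords) cross.

Crossing : (G : Graph) → (Fin (n G) → ℕ) → Set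
Crossing G σ = ∃[ a ] ∃[ b ] ∃[ c ] ∃[ d ]
  (Edge G a b × Edge G c d × σ a < σ c × σ c < σ b × σ b < σ d)

Outerplanar : Graph → Set
Outerplanar G = Σ (Fin (n G) → Fin (n G)) λ σ →
  (Injective _≡_ _≡_ σ × ¬ Crossing G (λ v → toℕ (σ v)))

addEdge : (G : Graph) → (u v : Fin (n G)) → u ≢ v → Graph
addEdge G u v u≢v = record
  { n = n G
  ; adj = λ x y → adj G x y ∨ (is x u ∧ is y v) ∨ (is x v ∧ is y u)
  ; sym = symP
  ; irref = irrP
  }
  where
  open import Data.Bool.Properties using (∨-comm; ∨-assoc; ∧-comm)
  open import Relation.Binary.PropositionalEquality using (refl; cong₂; trans; sym)
  open import Relation.Nullary using (yes; no)
  is : Fin (n G) → Fin (n G) → Bool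
  is x y = ⌊ x ≟ y ⌋
  A = adj G
  symP : ∀ x y → (A x y ∨ (is x u ∧ is y v) ∨ (is x v ∧ is y u))
               ≡ (A y x ∨ (is y u ∧ is x v) ∨ (is y v ∧ is x u))
  symP x y rewrite Graph.sym G x y
                 | ∧-comm (is x u) (is y v) | ∧-comm (is x v) (is y u)
                 = cong₂ _∨_ (refl {x = A y x}) (∨-comm (is y v ∧ is x u) (is y u ∧ is x v))
  irrP : ∀ x → (A x x ∨ (is x u ∧ is x v) ∨ (is x v ∧ is x u)) ≡ false
  irrP x rewrite irref G x with x ≟ u | x ≟ v
  ... | yes refl | yes refl = Data.Empty.⊥-elim (u≢v refl)
    where import Data.Empty
  ... | yes _ | no _ = refl
  ... | no _ | yes _ = refl
  ... | no _ | no _ = refl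

MaximalOuterplanar : Graph → Set
MaximalOuterplanar G =
  Outerplanar G ×
  (∀ u v → (u≢v : u ≢ v) → adj G u v ≡ false → ¬ Outerplanar (addEdge G u v u≢v))

-- Star edge colourings with k colours (colours Fin k; only values on
-- edges matter; symmetric so it is a function of the edge).

record StarEdgeColoring (G : Graph) (k : ℕ) : Set where
  field
    col    : Fin (n G) → Fin (n G) → Fin k
    colSym : ∀ u v → col u v ≡ col v u
    proper : ∀ u v w → Edge G u v → Edge G u w → v ≢ w → col u v ≢ col u w
    -- no path x0x1x2x3x4 (all distinct) nor cycle (x4 = x0, others distinct)
    -- of length four coloured with only two colours a, b
    noBicolored4 : ∀ x0 x1 x2 x3 x4 →
      Edge G x0 x1 → Edge G x1 x2 → Edge G x2 x3 → Edge G x3 x4 →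
      x0 ≢ x1 → x0 ≢ x2 → x0 ≢ x3 → x1 ≢ x2 → x1 ≢ x3 → x2 ≢ x3 →
      x4 ≢ x1 → x4 ≢ x2 → x4 ≢ x3 →
      ¬ (∃[ a ] ∃[ b ]
           ((col x0 x1 ≡ a ⊎ col x0 x1 ≡ b) × (col x1 x2 ≡ a ⊎ col x1 x2 ≡ b) ×
            (col x2 x3 ≡ a ⊎ col x2 x3 ≡ b) × (col x3 x4 ≡ a ⊎ col x3 x4 ≡ b)))

patternEdge : Fin 6 → Fin 6 → Bool
patternEdge i j = go (Data.Fin.toℕ i) (Data.Fin.toℕ j) ∨ go (Data.Fin.toℕ j) (Data.Fin.toℕ i)
  where
  import Data.Fin
  go : ℕ → ℕ → Bool
  go 0 2 = true
  go 0 3 = true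
  go 2 3 = true
  go 0 1 = true
  go 1 2 = true
  go 0 4 = true
  go 4 3 = true
  go 2 5 = true
  go 5 3 = true
  go _ _ = false

InducesPattern : (G : Graph) → (Fin 6 → Fin (n G)) → Set
InducesPattern G v = Injective _≡_ _≡_ v × (∀ i j → adj G (v i) (v j) ≡ patternEdge i j)

module Submission where

-- Suppose H has a star edge colouring with k ≤ Δ + 1
-- colours.  A vertex of degree Δ then sees all but at most one colour, since
-- its Δ distinct edge colours together with two missing colours would need
-- Δ + 2 colours.  Call the colour of the edge opposite to a vertex of the
-- central triangle v₀v₂v₃ its opposite colour.  Two facts about a pair of
-- triangle vertices x, y (with third vertex z):
--   * they do not both see their opposite colours, for otherwise the two
--     witnessing edges extend the path x z y to a bicoloured path of length 4;
--   * they do not both miss them: using the common neighbour w of x and y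
--     given by the pattern, x must then see the colour of wy and y the colour
--     of wx, again giving a bicoloured path around x w y.
-- So among three vertices no two agree on seeing their opposite colour,
-- which is impossible.

open import Defs
open import Data.Nat using (ℕ; _≤_; _+_; _≤?_)
open import Data.Fin using (Fin; #_)
open import Data.Product using (_×_; ∃-syntax; _,_)
open import Relation.Binary.PropositionalEquality using (_≡_)
open import Data.Nat.Properties using (+-comm)
open import Data.Fin.Properties using (injective⇒≤)
open import Data.Sum using (inj₁; inj₂)
open import Data.Empty using (⊥; ⊥-elim)
open import Data.Bool using (true)
open import Data.Bool.Properties using () renaming (_≟_ to _≟B_)
open import Data.List using (List; _∷_; length; map; filter; lookup; allFin)
open import Data.List.Properties using (length-map)
open import Data.List.Membership.Propositional.Properties using (∈-lookup)
open import Data.List.Relation.Unary.All as All using (All; []; _∷_)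
import Data.List.Relation.Unary.All.Properties as All
open import Data.List.Relation.Unary.AllPairs as AllPairs using (AllPairs; []; _∷_)
import Data.List.Relation.Unary.AllPairs.Properties as AllPairs
open import Data.List.Relation.Unary.Unique.Propositional.Properties using (allFin⁺)
open import Relation.Binary.PropositionalEquality
  using (refl; trans; cong; subst; _≢_; module ≡-Reasoning) renaming (sym to ≡-sym)
open import Relation.Nullary using (¬_)
open import Relation.Nullary.Decidable using (decidable-stable)
open import Function using (_∘_)

lookup-injective : ∀ {A : Set} {xs : List A} → AllPairs _≢_ xs →
                   ∀ i j → lookup xs i ≡ lookup xs j → i ≡ j
lookup-injective (_ ∷ _) Fin.zero Fin.zero _ = refl
lookup-injective (x∉xs ∷ _) Fin.zero (Fin.suc j) x≡xⱼ =
  ⊥-elim (All.lookup x∉xs (∈-lookup j) x≡xⱼ)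
lookup-injective (x∉xs ∷ _) (Fin.suc i) Fin.zero xᵢ≡x =
  ⊥-elim (All.lookup x∉xs (∈-lookup i) (≡-sym xᵢ≡x))
lookup-injective (_ ∷ xs!) (Fin.suc i) (Fin.suc j) xᵢ≡xⱼ =
  cong Fin.suc (lookup-injective xs! i j xᵢ≡xⱼ)

distinct⇒length≤ : ∀ {k} (xs : List (Fin k)) → AllPairs _≢_ xs → length xs ≤ k
distinct⇒length≤ xs xs! = injective⇒≤ (λ {i} {j} → lookup-injective xs! i j)

allPairs-relativise : ∀ {A : Set} {P : A → Set} {R : A → A → Set} {xs : List A} →
                      All P xs → AllPairs (λ a b → P a → P b → R a b) xs → AllPairs R xs
allPairs-relativise [] [] = []
allPairs-relativise (pa ∷ ps) (ra ∷ rs) =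
  All.zipWith (λ (r , pb) → r pa pb) (ra , ps) ∷ allPairs-relativise ps rs

neighbours : (G : Graph) → Fin (n G) → List (Fin (n G))
neighbours G u = filter (λ w → adj G u w ≟B true) (allFin (n G))

neighbour-edges : (G : Graph) (u : Fin (n G)) → All (Edge G u) (neighbours G u)
neighbour-edges G u = All.all-filter (λ w → adj G u w ≟B true) (allFin (n G))

edge-sym : (G : Graph) → ∀ {u w} → Edge G u w → Edge G w u
edge-sym G {u} {w} e = trans (Graph.sym G w u) e

edge⇒≢ : (G : Graph) → ∀ {u w} → Edge G u w → u ≢ w
edge⇒≢ G {u} e refl with trans (≡-sym e) (irref G u)
... | ()

module StarColouring {G : Graph} {k : ℕ} (C : StarEdgeColoring G k) where
  open StarEdgeColoring C

  Sees : Fin (n G) → Fin k → Set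
  Sees u α = ∃[ w ] (Edge G u w × col u w ≡ α)

  sees-flip : ∀ {u a b} → Sees u (col a b) → Sees u (col b a)
  sees-flip {u} {a} {b} = subst (Sees u) (colSym a b)

  colours-distinct : ∀ u → AllPairs _≢_ (map (col u) (neighbours G u))
  colours-distinct u =
    AllPairs.map⁺ (allPairs-relativise (neighbour-edges G u)
      (AllPairs.filter⁺ (λ w → adj G u w ≟B true)
        (AllPairs.map (λ w≢w' uw uw' → proper u _ _ uw uw' w≢w') (allFin⁺ (n G)))))

  missing-two : ∀ u {α β} → α ≢ β → ¬ Sees u α → ¬ Sees u β → degree G u + 2 ≤ k
  missing-two u {α} {β} α≢β ∌α ∌β =
    subst (_≤ k) length≡
      (distinct⇒length≤ (α ∷ β ∷ colours)
        ((α≢β ∷ avoids ∌α) ∷ avoids ∌β ∷ colours-distinct u))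
    where
    colours : List (Fin k)
    colours = map (col u) (neighbours G u)

    avoids : ∀ {γ} → ¬ Sees u γ → All (γ ≢_) colours
    avoids ∌γ = All.map⁺ (All.map (λ {w} uw γ≡ → ∌γ (w , uw , ≡-sym γ≡)) (neighbour-edges G u))

    length≡ : length (α ∷ β ∷ colours) ≡ degree G u + 2
    length≡ = begin
      2 + length colours                 ≡⟨ cong (2 +_) (length-map (col u) (neighbours G u)) ⟩
      2 + degree G u                     ≡⟨ +-comm 2 (degree G u) ⟩
      degree G u + 2                     ∎
      where open ≡-Reasoning

  MissesAtMostOne : Fin (n G) → Set
  MissesAtMostOne u = ∀ {α β} → α ≢ β → ¬ Sees u α → ¬ Sees u β → ⊥

  misses-at-most-one : ∀ u → ¬ (degree G u + 2 ≤ k) → MissesAtMostOne u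
  misses-at-most-one u few α≢β ∌α ∌β = few (missing-two u α≢β ∌α ∌β)

  -- An edge x₁w coloured like x₂x₃, on a path x₁x₂x₃, avoids x₂ and x₃:
  -- otherwise two edges at x₂ resp. x₃ would share a colour.
  avoids-path : ∀ {x₁ x₂ x₃ w} → Edge G x₁ x₂ → Edge G x₂ x₃ → x₁ ≢ x₃ →
                Edge G x₁ w → col x₁ w ≡ col x₂ x₃ → w ≢ x₂ × w ≢ x₃
  avoids-path {x₁} {x₂} {x₃} e₁₂ e₂₃ x₁≢x₃ e₁w c = at-x₂ , at-x₃
    where
    at-x₂ : _ ≢ x₂
    at-x₂ refl = proper x₂ x₁ x₃ (edge-sym G e₁₂) e₂₃ x₁≢x₃ (trans (colSym x₂ x₁) c)
    at-x₃ : _ ≢ x₃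
    at-x₃ refl = proper x₃ x₁ x₂ (edge-sym G e₁w) (edge-sym G e₂₃) (edge⇒≢ G e₁₂)
                   (trans (colSym x₃ x₁) (trans c (colSym x₂ x₃)))

  -- The star condition around a path x₁x₂x₃: x₁ cannot see the colour of
  -- x₂x₃ while x₃ sees the colour of x₂x₁, as the witnessing edges wx₁ and
  -- x₃w' would make w x₁ x₂ x₃ w' a bicoloured path (or cycle) of length 4.
  no-crossed-path : ∀ {x₁ x₂ x₃} → Edge G x₁ x₂ → Edge G x₂ x₃ → x₁ ≢ x₃ →
                    Sees x₁ (col x₂ x₃) → Sees x₃ (col x₂ x₁) → ⊥
  no-crossed-path {x₁} {x₂} {x₃} e₁₂ e₂₃ x₁≢x₃ (w , e₁w , c₁) (w' , e₃w' , c₃)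
    with avoids-path e₁₂ e₂₃ x₁≢x₃ e₁w c₁
       | avoids-path (edge-sym G e₂₃) (edge-sym G e₁₂) (λ eq → x₁≢x₃ (≡-sym eq)) e₃w' c₃
  ... | w≢x₂ , w≢x₃ | w'≢x₂ , w'≢x₁ =
    noBicolored4 w x₁ x₂ x₃ w' (edge-sym G e₁w) e₁₂ e₂₃ e₃w'
      (edge⇒≢ G (edge-sym G e₁w)) w≢x₂ w≢x₃ (edge⇒≢ G e₁₂) x₁≢x₃ (edge⇒≢ G e₂₃)
      w'≢x₁ w'≢x₂ (edge⇒≢ G (edge-sym G e₃w'))
      ( col x₁ x₂ , col x₂ x₃
      , inj₂ (trans (colSym w x₁) c₁) , inj₁ refl , inj₂ refl
      , inj₁ (trans c₃ (colSym x₂ x₁)))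

  -- In a triangle xyz, x and y do not both see the colour of their
  -- opposite edge (apply the star condition to the path x z y).
  triangle-sees : ∀ {x y z} → Edge G x y → Edge G y z → Edge G x z →
                  Sees x (col y z) → Sees y (col x z) → ⊥
  triangle-sees exy eyz exz sx sy =
    no-crossed-path exz (edge-sym G eyz) (edge⇒≢ G exy) (sees-flip sx) (sees-flip sy)

  -- If the edge xy of a triangle xyz also lies on a triangle xyw, and x, y
  -- each miss at most one colour, then they do not both miss the colour of
  -- their opposite edge: x would see the colour of wy, y that of wx.
  ear-misses : ∀ {x y z w} → MissesAtMostOne x → MissesAtMostOne y →
               Edge G x y → Edge G y z → Edge G x z → Edge G x w → Edge G y w → w ≢ z →
               ¬ Sees x (col y z) → ¬ Sees y (col x z) → ⊥
  ear-misses {x} {y} {z} {w} fx fy exy eyz exz exw eyw w≢z ∌x ∌y =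
    fx yz≢wy ∌x λ sx →
    fy xz≢wx ∌y λ sy →
    no-crossed-path exw (edge-sym G eyw) (edge⇒≢ G exy) sx sy
    where
    z≢w : z ≢ w
    z≢w eq = w≢z (≡-sym eq)
    yz≢wy : col y z ≢ col w y
    yz≢wy eq = proper y z w eyz eyw z≢w (trans eq (colSym w y))
    xz≢wx : col x z ≢ col w x
    xz≢wx eq = proper x z w exz exw z≢w (trans eq (colSym w x))

no-three-way : {A B C : Set} →
  (A → B → ⊥) → (A → C → ⊥) → (B → C → ⊥) →
  (¬ A → ¬ B → ⊥) → (¬ A → ¬ C → ⊥) → (¬ B → ¬ C → ⊥) → ⊥
no-three-way ab ac bc ¬a¬b ¬a¬c ¬b¬c =
  ¬a¬b (λ a → ¬b¬c (ab a) (ac a)) (λ b → ¬a¬c (λ a → ab a b) (bc b))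

theorem3p4 : (H : Graph) → (Δ : ℕ) →
    TwoConnected H → MaximalOuterplanar H → HasDiameter H 3 → IsMaxDegree H Δ →
    (v : Fin 6 → Fin (n H)) → InducesPattern H v →
    degree H (v Fin.zero) ≡ Δ → degree H (v (Fin.suc (Fin.suc Fin.zero))) ≡ Δ →
    degree H (v (Fin.suc (Fin.suc (Fin.suc Fin.zero)))) ≡ Δ →
    (k : ℕ) → StarEdgeColoring H k → Δ + 2 ≤ k
theorem3p4 H Δ _ _ _ _ v (v-inj , induced) d₀ d₂ d₃ k C =
  decidable-stable (Δ + 2 ≤? k) too-few-colours
  where
  open StarEdgeColoring C using (col)
  open StarColouring C

  distinct : ∀ {i j} → i ≢ j → v i ≢ v j
  distinct i≢j vi≡vj = i≢j (v-inj vi≡vj)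

  too-few-colours : ¬ (Δ + 2 ≤ k) → ⊥
  too-few-colours few =
    no-three-way {A = Sees (v (# 0)) (col (v (# 2)) (v (# 3)))}
                 {B = Sees (v (# 2)) (col (v (# 0)) (v (# 3)))}
                 {C = Sees (v (# 3)) (col (v (# 0)) (v (# 2)))}
      (triangle-sees (induced _ _) (induced _ _) (induced _ _))
      (λ s₀ → triangle-sees (induced _ _) (induced _ _) (induced _ _) (sees-flip s₀))
      (λ s₂ s₃ → triangle-sees (induced _ _) (induced _ _) (induced _ _) (sees-flip s₂) (sees-flip s₃))
      (ear-misses (full d₀) (full d₂) (induced _ _) (induced _ _) (induced _ _)
                  (induced _ (# 1)) (induced _ _) (distinct λ ()))
      (λ ∌₀ → ear-misses (full d₀) (full d₃) (induced _ _) (induced _ _) (induced _ _)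
                  (induced _ (# 4)) (induced _ _) (distinct λ ()) (∌₀ ∘ sees-flip))
      (λ ∌₂ ∌₃ → ear-misses (full d₂) (full d₃) (induced _ _) (induced _ _) (induced _ _)
                  (induced _ (# 5)) (induced _ _) (distinct λ ()) (∌₂ ∘ sees-flip) (∌₃ ∘ sees-flip))
    where
    full : ∀ {u} → degree H u ≡ Δ → MissesAtMostOne u
    full {u} dᵤ = misses-at-most-one u (subst (λ d → ¬ (d + 2 ≤ k)) (≡-sym dᵤ) few)
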